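{- Let $\Pi$ be the map on $\mathbb{N}=\{1,2,3,\dots\}$ produced by the following procedure. At step $1$ set $\Pi(1)=1$. For $m=2,3,4,\dots$ in turn, at step $m$: if $\Pi(m-\lfloor m/2\rfloor)$ has not been assigned at an earlier step, set $\Pi(m-\lfloor m/2\rfloor)=m$; otherwise set $\Pi(m+\lfloor m/2\rfloor)=m$. Let $\sigma$ be the morphism of the free monoid $\{1,3,4\}^*$ given by $\sigma(1)=114$, $\sigma(3)=314$, $\sigma(4)=314$, and let $s=s_1s_2s_3\dots=114114314\dots$ be the fixed point of $\sigma$ with first letter $1$. Then for every $n\ge1$: $s_n=1$ iff $\Pi(n)$ has type (I); $s_n=3$ iff $\Pi(n)$ has type (III); $s_n=4$ iff $\Pi(n)$ has type (IV).
   Context: The procedure assigns a value $\Pi(n)$ to every $n\in\mathbb{N}$. Types: for $n\ge 2$, $\Pi(n)$ has type (I) if $\Pi(n)>n$ and $\Pi(n)=2n-1$; type (II) if $\Pi(n)>n$ and $\Pi(n)=2n$; type (III) if $\Pi(n)<n$ and $\Pi(n)=(2n+1)/3$; type (IV) if $\Pi(n)<n$ and $\Pi(n)=2n/3$. By convention $\Pi(1)=1$ is said to have type (I) (and no other type). -}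

module Defs where

open import Data.Nat using (ℕ; zero; suc; _+_; _*_; _∸_; _/_; _≤_; _<_; _≡ᵇ_)
open import Data.Bool using (if_then_else_)
open import Data.Maybe using (Maybe; just; nothing)
open import Data.Fin using (Fin; toℕ)
open import Data.Vec using (Vec; []; _∷_; lookup)
open import Data.Product using (_×_; ∃)
open import Data.Sum using (_⊎_)
open import Relation.Binary.PropositionalEquality using (_≡_)

Assignment : Set
Assignment = ℕ → Maybe ℕ

empty : Assignment
empty _ = nothing

update : ℕ → ℕ → Assignment → Assignment
update p v f k = if k ≡ᵇ p then just v else f k

stepWith : ℕ → Assignment → Maybe ℕ → Assignment
stepWith m f nothing  = update (m ∸ m / 2) m f
stepWith m f (just _) = update (m + m / 2) m f

step : ℕ → Assignment → Assignment
step m f = stepWith m f (f (m ∸ m / 2))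

state : ℕ → Assignment
state zero = empty
state (suc zero) = update 1 1 empty
state (suc (suc k)) = step (suc (suc k)) (state (suc k))

-- Π(n): only steps m ≤ 2n can write to position n, so the value of
-- position n after step 2n is its final value.
Π : ℕ → Maybe ℕ
Π n = state (2 * n) n

TypeI : ℕ → Set
TypeI n = (n ≡ 1) ⊎ (2 ≤ n × ∃ λ m → Π n ≡ just m × n < m × m ≡ 2 * n ∸ 1)

TypeII : ℕ → Set
TypeII n = 2 ≤ n × ∃ λ m → Π n ≡ just m × n < m × m ≡ 2 * n

TypeIII : ℕ → Set
TypeIII n = 2 ≤ n × ∃ λ m → Π n ≡ just m × m < n × 3 * m ≡ 2 * n + 1

TypeIV : ℕ → Set
TypeIV n = 2 ≤ n × ∃ λ m → Π n ≡ just m × m < n × 3 * m ≡ 2 * n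

data Letter : Set where
  one three four : Letter

σ : Letter → Vec Letter 3
σ one   = one ∷ one ∷ four ∷ []
σ three = three ∷ one ∷ four ∷ []
σ four  = three ∷ one ∷ four ∷ []

-- An infinite word w is given 0-indexed: w i is the letter s_{i+1}.
-- w is a fixed point of σ iff σ(w) = w, i.e. the block of σ(w) coming
-- from letter w i occupies positions 3i, 3i+1, 3i+2.
IsFixedPoint : (ℕ → Letter) → Set
IsFixedPoint w = ∀ (i : ℕ) (j : Fin 3) → w (3 * i + toℕ j) ≡ lookup (σ (w i)) j

module Submission where

-- Letter x at
-- position n predicts the value Π(n) = predicted x n, where
--   predicted 1 n = 2n − 1,   predicted 3 n = (2n+1)/3,   predicted 4 n = 2n/3.
--
-- 1. Arithmetic of predicted values, and why they have the types (I), (III),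
--    (IV); the three types are mutually exclusive, so a type fixes a letter.
-- 2. The procedure, for an arbitrary candidate P for Π: let `expected m`
--    be the assignment holding P k at each position k with P k ≤ m.  If the
--    position `writePos M` that step M would write when the state is
--    `expected (M − 1)` always satisfies P (writePos M) = M, and conversely
--    writePos (P k) = k, then by induction the procedure really produces
--    `expected m` after step m, hence Π(n) = P n whenever P n ≤ 2n.
-- 3. For the fixed point s, the blocks σ(s_{q+1}) = s_{3q+1} s_{3q+2} s_{3q+3}
--    locate every letter (1 anywhere, 3 only at 3q+1 with q ≥ 1 and
--    s_{q+1} ≠ 1, 4 only at 3q+3).  From this P n = predicted s_n n meets
--    the hypotheses of 2, so Π(n) = predicted s_n n, and 1 gives the theorem.

open import Defs
open import Data.Nat using (ℕ; zero; suc; _+_; _*_; _∸_; _/_; _≤_; _<_; _≡ᵇ_; z≤n; s≤s; _≤?_)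
open import Data.Nat.Properties
  using (≤-reflexive; ≤-trans; m≤m+n; m≤n⇒m≤1+n; n≤1+n; ≤-<-connex; ≤∧≢⇒<; <-asym;
         1+n≢n; ≤⇒≯; _≟_; +-comm; *-comm; m+n∸n≡m; ≡ᵇ⇒≡; ≡⇒≡ᵇ)
open import Data.Nat.DivMod using (m*n/n≡m; +-distrib-/-∣ʳ)
open import Data.Nat.Divisibility using (divides-refl)
open import Data.Nat.Tactic.RingSolver using (solve-∀)
open import Data.Bool using (true; false; if_then_else_)
open import Data.Maybe using (Maybe; just; nothing)
open import Data.Maybe.Properties using (just-injective)
open import Data.Fin using (Fin; toℕ) renaming (zero to fzero; suc to fsuc)
open import Data.Vec using (lookup)
open import Data.Product using (_×_; _,_; ∃-syntax)
open import Data.Sum using (inj₁; inj₂)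
open import Data.Empty using (⊥; ⊥-elim)
open import Function.Bundles using (_⇔_; mk⇔)
open import Relation.Nullary using (Dec; yes; no; contradiction)
open import Relation.Binary.PropositionalEquality
open ≡-Reasoning

≤-by : ∀ {a b} c → a + c ≡ b → a ≤ b
≤-by {a} c refl = m≤m+n a c

half-even : ∀ q → q * 2 / 2 ≡ q
half-even q = m*n/n≡m q 2

half-odd : ∀ q → (1 + q * 2) / 2 ≡ q
half-odd q = trans (+-distrib-/-∣ʳ 1 {q * 2} {2} (divides-refl q)) (half-even q)

rest-even : ∀ q → q * 2 ∸ q * 2 / 2 ≡ q
rest-even q = begin
  q * 2 ∸ q * 2 / 2  ≡⟨ cong (q * 2 ∸_) (half-even q) ⟩
  q * 2 ∸ q          ≡⟨ cong (_∸ q) (double q) ⟩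
  q + q ∸ q          ≡⟨ m+n∸n≡m q q ⟩
  q                  ∎
  where
  double : ∀ q → q * 2 ≡ q + q
  double = solve-∀

rest-odd : ∀ q → 1 + q * 2 ∸ (1 + q * 2) / 2 ≡ suc q
rest-odd q = begin
  1 + q * 2 ∸ (1 + q * 2) / 2  ≡⟨ cong (1 + q * 2 ∸_) (half-odd q) ⟩
  1 + q * 2 ∸ q                ≡⟨ cong (_∸ q) (double q) ⟩
  suc q + q ∸ q                ≡⟨ m+n∸n≡m (suc q) q ⟩
  suc q                        ∎
  where
  double : ∀ q → 1 + q * 2 ≡ suc q + q
  double = solve-∀

predicted : Letter → ℕ → ℕ
predicted one   n = 2 * n ∸ 1
predicted three n = (2 * n + 1) / 3
predicted four  n = 2 * n / 3

predicted-one : ∀ j → predicted one (suc j) ≡ 1 + j * 2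
predicted-one j = cong (_∸ 1) (double-suc j)
  where
  double-suc : ∀ j → 2 * suc j ≡ 2 + j * 2
  double-suc = solve-∀

predicted-three : ∀ q → predicted three (1 + q * 3) ≡ 1 + q * 2
predicted-three q = trans (cong (_/ 3) (factor q)) (m*n/n≡m (1 + q * 2) 3)
  where
  factor : ∀ q → 2 * (1 + q * 3) + 1 ≡ (1 + q * 2) * 3
  factor = solve-∀

predicted-four : ∀ q → predicted four (3 + q * 3) ≡ 2 + q * 2
predicted-four q = trans (cong (_/ 3) (factor q)) (m*n/n≡m (2 + q * 2) 3)
  where
  factor : ∀ q → 2 * (3 + q * 3) ≡ (2 + q * 2) * 3
  factor = solve-∀

HasType : Letter → ℕ → Set
HasType one   = TypeI
HasType three = TypeIII
HasType four  = TypeIV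

typeI-of : ∀ j → Π (suc j) ≡ just (predicted one (suc j)) → TypeI (suc j)
typeI-of zero    _   = inj₁ refl
typeI-of (suc k) Π≡ = inj₂ (s≤s (s≤s z≤n) , predicted one (2 + k) , Π≡ , grows , refl)
  where
  excess : ∀ k → 3 + k + k ≡ 1 + suc k * 2
  excess = solve-∀
  grows : 2 + k < predicted one (2 + k)
  grows = ≤-by k (trans (excess k) (sym (predicted-one (suc k))))

typeIII-of : ∀ q → Π (1 + suc q * 3) ≡ just (predicted three (1 + suc q * 3)) →
             TypeIII (1 + suc q * 3)
typeIII-of q Π≡ =
  s≤s (s≤s z≤n) , 1 + suc q * 2 , trans Π≡ (cong just (predicted-three (suc q))) ,
  ≤-by q (excess q) , thirds q
  where
  excess : ∀ q → 2 + suc q * 2 + q ≡ 1 + suc q * 3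
  excess = solve-∀
  thirds : ∀ q → 3 * (1 + suc q * 2) ≡ 2 * (1 + suc q * 3) + 1
  thirds = solve-∀

typeIV-of : ∀ q → Π (3 + q * 3) ≡ just (predicted four (3 + q * 3)) → TypeIV (3 + q * 3)
typeIV-of q Π≡ =
  s≤s (s≤s z≤n) , 2 + q * 2 , trans Π≡ (cong just (predicted-four q)) ,
  ≤-by q (excess q) , thirds q
  where
  excess : ∀ q → 3 + q * 2 + q ≡ 3 + q * 3
  excess = solve-∀
  thirds : ∀ q → 3 * (2 + q * 2) ≡ 2 * (3 + q * 3)
  thirds = solve-∀

typeI-not-smaller : ∀ {n m} → TypeI n → 2 ≤ n → Π n ≡ just m → m < n → ⊥
typeI-not-smaller (inj₁ refl) (s≤s ()) _ _
typeI-not-smaller (inj₂ (_ , _ , Π≡′ , n<m′ , _)) _ Π≡ m<n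
  with just-injective (trans (sym Π≡′) Π≡)
... | refl = <-asym n<m′ m<n

-- Types (III) and (IV) would force 2n + 1 = 3·Π(n) = 2n.
typeIII-not-IV : ∀ {n} → TypeIII n → TypeIV n → ⊥
typeIII-not-IV {n} (_ , m , Π≡ , _ , thirdsIII) (_ , _ , Π≡′ , _ , thirdsIV)
  with just-injective (trans (sym Π≡) Π≡′)
... | refl = 1+n≢n (trans (+-comm 1 (2 * n)) (trans (sym thirdsIII) thirdsIV))

type-determines-letter : ∀ {x y n} → HasType x n → HasType y n → x ≡ y
type-determines-letter {one}   {one}   _ _ = refl
type-determines-letter {one}   {three} t (2≤n , _ , Π≡ , m<n , _) = ⊥-elim (typeI-not-smaller t 2≤n Π≡ m<n)
type-determines-letter {one}   {four}  t (2≤n , _ , Π≡ , m<n , _) = ⊥-elim (typeI-not-smaller t 2≤n Π≡ m<n)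
type-determines-letter {three} {one}   (2≤n , _ , Π≡ , m<n , _) t = ⊥-elim (typeI-not-smaller t 2≤n Π≡ m<n)
type-determines-letter {three} {three} _ _ = refl
type-determines-letter {three} {four}  t t′ = ⊥-elim (typeIII-not-IV t t′)
type-determines-letter {four}  {one}   (2≤n , _ , Π≡ , m<n , _) t = ⊥-elim (typeI-not-smaller t 2≤n Π≡ m<n)
type-determines-letter {four}  {three} t t′ = ⊥-elim (typeIII-not-IV t′ t)
type-determines-letter {four}  {four}  _ _ = refl

target : ℕ → Maybe ℕ → ℕ
target M nothing  = M ∸ M / 2
target M (just _) = M + M / 2

step-update : ∀ M f k → step M f k ≡ update (target M (f (M ∸ M / 2))) M f k
step-update M f k with f (M ∸ M / 2)
... | nothing = refl
... | just _  = refl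

-- Step 1 is an ordinary step.
state-suc : ∀ m k → state (suc m) k ≡ step (suc m) (state m) k
state-suc zero    k = refl
state-suc (suc m) k = refl

update-here : ∀ p v f → update p v f p ≡ just v
update-here p v f with p ≡ᵇ p | ≡⇒≡ᵇ p p refl
... | true  | _  = refl
... | false | ()

update-there : ∀ {p k} v f → k ≢ p → update p v f k ≡ f k
update-there {p} {k} v f k≢p with k ≡ᵇ p | ≡ᵇ⇒≡ k p
... | false | _    = refl
... | true  | k≡p = contradiction (k≡p _) k≢p

update-cong : ∀ p v {f g} k → f k ≡ g k → update p v f k ≡ update p v g k
update-cong p v k fk≡gk = cong (λ o → if k ≡ᵇ p then just v else o) fk≡gk

module Procedure (P : ℕ → ℕ) where

  expected : ℕ → Assignment
  expected m zero = nothing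
  expected m (suc j) with P (suc j) ≤? m
  ... | yes _ = just (P (suc j))
  ... | no _  = nothing

  expected-yes : ∀ {m j} → P (suc j) ≤ m → expected m (suc j) ≡ just (P (suc j))
  expected-yes {m} {j} le with P (suc j) ≤? m
  ... | yes _  = refl
  ... | no ¬le = contradiction le ¬le

  expected-no : ∀ {m j} → m < P (suc j) → expected m (suc j) ≡ nothing
  expected-no {m} {j} lt with P (suc j) ≤? m
  ... | yes le = contradiction lt (≤⇒≯ le)
  ... | no _   = refl

  writePos : ℕ → ℕ
  writePos M = target M (expected (M ∸ 1) (M ∸ M / 2))

  writePos-even : ∀ q → P (suc q) ≤ 1 + q * 2 → writePos (suc q * 2) ≡ suc q * 3
  writePos-even q filled = begin
    target M (expected (1 + q * 2) (M ∸ M / 2))  ≡⟨ cong (λ h → target M (expected (1 + q * 2) h)) (rest-even (suc q)) ⟩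
    target M (expected (1 + q * 2) (suc q))      ≡⟨ cong (target M) (expected-yes filled) ⟩
    M + M / 2                                    ≡⟨ cong (M +_) (half-even (suc q)) ⟩
    M + suc q                                    ≡⟨ triple q ⟩
    suc q * 3                                    ∎
    where
    M : ℕ
    M = suc q * 2
    triple : ∀ q → suc q * 2 + suc q ≡ suc q * 3
    triple = solve-∀

  writePos-odd-free : ∀ q → q * 2 < P (suc q) → writePos (1 + q * 2) ≡ suc q
  writePos-odd-free q free = begin
    target M (expected (q * 2) (M ∸ M / 2))  ≡⟨ cong (λ h → target M (expected (q * 2) h)) (rest-odd q) ⟩
    target M (expected (q * 2) (suc q))      ≡⟨ cong (target M) (expected-no free) ⟩
    M ∸ M / 2                                ≡⟨ rest-odd q ⟩
    suc q                                    ∎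
    where
    M : ℕ
    M = 1 + q * 2

  writePos-odd-taken : ∀ q → P (suc q) ≤ q * 2 → writePos (1 + q * 2) ≡ suc (q * 3)
  writePos-odd-taken q filled = begin
    target M (expected (q * 2) (M ∸ M / 2))  ≡⟨ cong (λ h → target M (expected (q * 2) h)) (rest-odd q) ⟩
    target M (expected (q * 2) (suc q))      ≡⟨ cong (target M) (expected-yes filled) ⟩
    M + M / 2                                ≡⟨ cong (M +_) (half-odd q) ⟩
    M + q                                    ≡⟨ triple q ⟩
    suc (q * 3)                              ∎
    where
    M : ℕ
    M = 1 + q * 2
    triple : ∀ q → 1 + q * 2 + q ≡ suc (q * 3)
    triple = solve-∀

  module Correctness
    (hit  : ∀ m → ∃[ j ] writePos (suc m) ≡ suc j × P (suc j) ≡ suc m)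
    (only : ∀ j → writePos (P (suc j)) ≡ suc j)
    where

    -- Step 0 would write position 0, so no position k ≥ 1 has P k = 0.
    P-pos : ∀ j → 0 < P (suc j)
    P-pos j with P (suc j) in P≡
    ... | suc _ = s≤s z≤n
    ... | zero  = contradiction (trans (cong writePos (sym P≡)) (only j)) (λ ())

    expected-written : ∀ m → expected (suc m) (writePos (suc m)) ≡ just (suc m)
    expected-written m with hit m
    ... | j , w≡ , P≡ rewrite w≡ = trans (expected-yes (≤-reflexive P≡)) (cong just P≡)

    expected-unchanged : ∀ m k → k ≢ writePos (suc m) → expected m k ≡ expected (suc m) k
    expected-unchanged m zero    _   = refl
    expected-unchanged m (suc i) k≢w with ≤-<-connex (P (suc i)) m
    ... | inj₁ P≤m = trans (expected-yes P≤m) (sym (expected-yes (m≤n⇒m≤1+n P≤m)))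
    ... | inj₂ m<P = trans (expected-no m<P) (sym (expected-no (≤∧≢⇒< m<P not-written)))
      where
      not-written : suc m ≢ P (suc i)
      not-written m≡P = k≢w (sym (trans (cong writePos m≡P) (only i)))

    expected-step : ∀ m k → update (writePos (suc m)) (suc m) (expected m) k ≡ expected (suc m) k
    expected-step m k with k ≟ writePos (suc m)
    ... | yes refl = trans (update-here (writePos (suc m)) (suc m) (expected m)) (sym (expected-written m))
    ... | no k≢w  = trans (update-there (suc m) (expected m) k≢w) (expected-unchanged m k k≢w)

    state-expected : ∀ m k → state m k ≡ expected m k
    state-expected zero    zero    = refl
    state-expected zero    (suc j) = sym (expected-no (P-pos j))
    state-expected (suc m) k = begin
      state (suc m) k                                             ≡⟨ state-suc m k ⟩
      step (suc m) (state m) k                                    ≡⟨ step-update (suc m) (state m) k ⟩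
      update (target (suc m) (state m h)) (suc m) (state m) k     ≡⟨ cong (λ o → update (target (suc m) o) (suc m) (state m) k) (state-expected m h) ⟩
      update (writePos (suc m)) (suc m) (state m) k               ≡⟨ update-cong (writePos (suc m)) (suc m) {state m} {expected m} k (state-expected m k) ⟩
      update (writePos (suc m)) (suc m) (expected m) k            ≡⟨ expected-step m k ⟩
      expected (suc m) k                                          ∎
      where
      h : ℕ
      h = suc m ∸ suc m / 2

σ-second : ∀ x → lookup (σ x) (fsuc fzero) ≡ one
σ-second one   = refl
σ-second three = refl
σ-second four  = refl

σ-third : ∀ x → lookup (σ x) (fsuc (fsuc fzero)) ≡ four
σ-third one   = refl
σ-third three = refl
σ-third four  = refl

σ-first-other : ∀ {x} → x ≢ one → lookup (σ x) fzero ≡ three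
σ-first-other {one}   x≢one = contradiction refl x≢one
σ-first-other {three} _     = refl
σ-first-other {four}  _     = refl

one? : ∀ x → Dec (x ≡ one)
one? one   = yes refl
one? three = no (λ ())
one? four  = no (λ ())

data Mod3 : ℕ → Set where
  rem0 : ∀ q → Mod3 (q * 3)
  rem1 : ∀ q → Mod3 (1 + q * 3)
  rem2 : ∀ q → Mod3 (2 + q * 3)

mod3 : ∀ j → Mod3 j
mod3 0 = rem0 0
mod3 1 = rem1 0
mod3 2 = rem2 0
mod3 (suc (suc (suc j))) with mod3 j
... | rem0 q = rem0 (suc q)
... | rem1 q = rem1 (suc q)
... | rem2 q = rem2 (suc q)

data Parity : ℕ → Set where
  even : ∀ q → Parity (q * 2)
  odd  : ∀ q → Parity (1 + q * 2)

parity : ∀ m → Parity m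
parity 0 = even 0
parity 1 = odd 0
parity (suc (suc m)) with parity m
... | even q = even (suc q)
... | odd q  = odd (suc q)

module FixedPoint (s : ℕ → Letter) (s0 : s 0 ≡ one) (fp : IsFixedPoint s) where

  s-block : ∀ q (i : Fin 3) → s (toℕ i + q * 3) ≡ lookup (σ (s q)) i
  s-block q i = subst (λ k → s k ≡ lookup (σ (s q)) i) reorder (fp q i)
    where
    reorder : 3 * q + toℕ i ≡ toℕ i + q * 3
    reorder = trans (+-comm (3 * q) (toℕ i)) (cong (toℕ i +_) (*-comm 3 q))

  s-first-one : ∀ {q} → s q ≡ one → s (q * 3) ≡ one
  s-first-one {q} sq≡one = trans (s-block q fzero) (cong (λ x → lookup (σ x) fzero) sq≡one)

  s-first-other : ∀ {q} → s q ≢ one → s (q * 3) ≡ three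
  s-first-other {q} sq≢one = trans (s-block q fzero) (σ-first-other sq≢one)

  s-second : ∀ q → s (1 + q * 3) ≡ one
  s-second q = trans (s-block q (fsuc fzero)) (σ-second (s q))

  s-third : ∀ q → s (2 + q * 3) ≡ four
  s-third q = trans (s-block q (fsuc (fsuc fzero))) (σ-third (s q))

  data LetterAt : ℕ → Set where
    one-at   : ∀ {j} → s j ≡ one → LetterAt j
    three-at : ∀ q → s (suc q * 3) ≡ three → s (suc q) ≢ one → LetterAt (suc q * 3)
    four-at  : ∀ q → s (2 + q * 3) ≡ four → LetterAt (2 + q * 3)

  letterAt : ∀ j → LetterAt j
  letterAt j with mod3 j
  ... | rem1 q = one-at (s-second q)
  ... | rem2 q = four-at q (s-third q)
  ... | rem0 q with one? (s q)
  ...   | yes sq≡one = one-at (s-first-one sq≡one)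
  ...   | no sq≢one with q
  ...     | zero  = contradiction s0 sq≢one
  ...     | suc p = three-at p (s-first-other sq≢one) sq≢one

  P : ℕ → ℕ
  P n = predicted (s (n ∸ 1)) n

  open Procedure P

  P-at : ∀ {j x} → s j ≡ x → P (suc j) ≡ predicted x (suc j)
  P-at {j} sj≡x = cong (λ x → predicted x (suc j)) sj≡x

  P-one : ∀ {j} → s j ≡ one → P (suc j) ≡ 1 + j * 2
  P-one {j} sj≡one = trans (P-at sj≡one) (predicted-one j)

  P-below-other : ∀ j → s j ≢ one → P (suc j) ≤ j * 2
  P-below-other j sj≢one with letterAt j
  ... | one-at sj≡one = contradiction sj≡one sj≢one
  ... | three-at q sj≡three _ =
    ≤-by (3 + q * 4) (trans (cong (_+ (3 + q * 4)) (trans (P-at sj≡three) (predicted-three (suc q)))) (excess q))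
    where
    excess : ∀ q → 1 + suc q * 2 + (3 + q * 4) ≡ suc q * 3 * 2
    excess = solve-∀
  ... | four-at q sj≡four =
    ≤-by (2 + q * 4) (trans (cong (_+ (2 + q * 4)) (trans (P-at sj≡four) (predicted-four q))) (excess q))
    where
    excess : ∀ q → 2 + q * 2 + (2 + q * 4) ≡ (2 + q * 3) * 2
    excess = solve-∀

  P-below : ∀ j → P (suc j) ≤ 1 + j * 2
  P-below j with one? (s j)
  ... | yes sj≡one = ≤-reflexive (P-one sj≡one)
  ... | no sj≢one  = ≤-trans (P-below-other j sj≢one) (n≤1+n (j * 2))

  writes-odd-one : ∀ q → s q ≡ one → writePos (1 + q * 2) ≡ suc q
  writes-odd-one q sq≡one = writePos-odd-free q (≤-reflexive (sym (P-one sq≡one)))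

  writes-odd-other : ∀ q → s q ≢ one → writePos (1 + q * 2) ≡ suc (q * 3)
  writes-odd-other q sq≢one = writePos-odd-taken q (P-below-other q sq≢one)

  writes-even : ∀ q → writePos (suc q * 2) ≡ suc q * 3
  writes-even q = writePos-even q (P-below q)

  hit : ∀ m → ∃[ j ] writePos (suc m) ≡ suc j × P (suc j) ≡ suc m
  hit m with parity m
  ... | odd q = 2 + q * 3 , writes-even q , trans (P-at (s-third q)) (predicted-four q)
  ... | even q with one? (s q)
  ...   | yes sq≡one = q , writes-odd-one q sq≡one , P-one sq≡one
  ...   | no sq≢one  = q * 3 , writes-odd-other q sq≢one ,
                        trans (P-at (s-first-other sq≢one)) (predicted-three q)

  only : ∀ j → writePos (P (suc j)) ≡ suc j
  only j with letterAt j
  ... | one-at sj≡one = trans (cong writePos (P-one sj≡one)) (writes-odd-one j sj≡one)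
  ... | three-at q sj≡three sq≢one =
    trans (cong writePos (trans (P-at sj≡three) (predicted-three (suc q)))) (writes-odd-other (suc q) sq≢one)
  ... | four-at q sj≡four =
    trans (cong writePos (trans (P-at sj≡four) (predicted-four q))) (writes-even q)

  open Correctness hit only using (state-expected)

  Π-value : ∀ j → Π (suc j) ≡ just (P (suc j))
  Π-value j = trans (state-expected (2 * suc j) (suc j)) (expected-yes (≤-trans (P-below j) (≤-by 1 (room j))))
    where
    room : ∀ j → 1 + j * 2 + 1 ≡ 2 * suc j
    room = solve-∀

  has-type : ∀ j → HasType (s j) (suc j)
  has-type j with letterAt j
  ... | one-at sj≡one =
    subst (λ x → HasType x (suc j)) (sym sj≡one) (typeI-of j (trans (Π-value j) (cong just (P-at sj≡one))))
  ... | three-at q sj≡three _ =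
    subst (λ x → HasType x (suc j)) (sym sj≡three) (typeIII-of q (trans (Π-value j) (cong just (P-at sj≡three))))
  ... | four-at q sj≡four =
    subst (λ x → HasType x (suc j)) (sym sj≡four) (typeIV-of q (trans (Π-value j) (cong just (P-at sj≡four))))

theorem2 : (s : ℕ → Letter) → s 0 ≡ one → IsFixedPoint s →
    ∀ (n : ℕ) → 1 ≤ n →
      ((s (n ∸ 1) ≡ one) ⇔ TypeI n) ×
      ((s (n ∸ 1) ≡ three) ⇔ TypeIII n) ×
      ((s (n ∸ 1) ≡ four) ⇔ TypeIV n)
theorem2 s s0 fp zero    ()
theorem2 s s0 fp (suc j) _ = letter-iff one , letter-iff three , letter-iff four
  where
  open FixedPoint s s0 fp using (has-type)
  letter-iff : ∀ x → (s j ≡ x) ⇔ HasType x (suc j)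
  letter-iff x = mk⇔ (λ sj≡x → subst (λ y → HasType y (suc j)) sj≡x (has-type j))
                     (type-determines-letter (has-type j))
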